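{- Let $\epsilon>0$, $n=|J|$, and consider the integer program $P$: maximize $\sum_{j\in J} w_jx_j$ subject to $\sum_{j\in J} p_{ij}x_j\le s_i$ for all $i\in M$, $x_j\in\{0,1\}$ for all $j\in J$, where $w_j,p_{ij}\ge0$ and $s_i>0$. For each $i\in M$ let $b_i=\frac{\epsilon}{n+1}s_i$, $\widehat{p_{ij}}=\lfloor p_{ij}/b_i\rfloor$ and $\widehat{s_i}=\lceil s_i/b_i\rceil$, and let $\widehat P$ be the integer program obtained from $P$ by replacing $p_{ij}$ by $\widehat{p_{ij}}$ and $s_i$ by $\widehat{s_i}$ (weights unchanged). Then the optimal value of $\widehat P$ is at least that of $P$, and if $S$ is the set of jobs $j$ with $x_j=1$ in an optimal solution of $\widehat P$, then $\sum_{j\in S} p_{ij}\le(1+\epsilon)s_i$ for every $i\in M$.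
   Context: $J$ is a finite set of items (jobs) and $M$ a finite set of dimensions (machines).
   Formalization: The parameter ε and the data $w_j$, $p_{ij}$ and $s_i$ of the program P are rational. -}

module Defs where

open import Data.Nat using (ℕ; zero; suc)
open import Data.Fin using (Fin)
open import Data.Bool using (Bool; if_then_else_)
open import Data.Integer as ℤ using (ℤ)
open import Data.Rational as ℚ using (ℚ; 0ℚ; 1ℚ; _+_; _*_; _÷_; _≤_; floor; ceiling; ≢-nonZero; _≟_)
open import Relation.Nullary using (yes; no)

Σℚ : ∀ {n} → (Fin n → ℚ) → ℚ
Σℚ {zero}  f = 0ℚ
Σℚ {suc n} f = f Fin.zero + Σℚ (λ j → f (Fin.suc j))

Σℤ : ∀ {n} → (Fin n → ℤ) → ℤ
Σℤ {zero}  f = ℤ.+ 0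
Σℤ {suc n} f = f Fin.zero ℤ.+ Σℤ (λ j → f (Fin.suc j))

-- Division of rationals, total by convention (x / 0 := 0); only used
-- with nonzero divisors under the hypotheses of the statement.
_/ℚ_ : ℚ → ℚ → ℚ
p /ℚ q with q ≟ 0ℚ
... | yes _   = 0ℚ
... | no q≢0  = _÷_ p q {{≢-nonZero q≢0}}

-- A 0/1 vector x : Fin n → Bool ; x j = true means x_j = 1.
-- Σ_j a_j x_j  over ℚ and over ℤ.
selℚ : ∀ {n} → (Fin n → Bool) → (Fin n → ℚ) → ℚ
selℚ x a = Σℚ (λ j → if x j then a j else 0ℚ)

selℤ : ∀ {n} → (Fin n → Bool) → (Fin n → ℤ) → ℤ
selℤ x a = Σℤ (λ j → if x j then a j else ℤ.+ 0)

FeasibleP : ∀ {m n} → (Fin m → Fin n → ℚ) → (Fin m → ℚ) → (Fin n → Bool) → Set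
FeasibleP p s x = ∀ i → selℚ x (p i) ≤ s i

OptimalP : ∀ {m n} → (Fin n → ℚ) → (Fin m → Fin n → ℚ) → (Fin m → ℚ) → (Fin n → Bool) → Set
OptimalP w p s x = FeasibleP p s x × (∀ y → FeasibleP p s y → selℚ y w ≤ selℚ x w)
  where open import Data.Product using (_×_)

FeasibleP̂ : ∀ {m n} → (Fin m → Fin n → ℤ) → (Fin m → ℤ) → (Fin n → Bool) → Set
FeasibleP̂ p s x = ∀ i → selℤ x (p i) ℤ.≤ s i

OptimalP̂ : ∀ {m n} → (Fin n → ℚ) → (Fin m → Fin n → ℤ) → (Fin m → ℤ) → (Fin n → Bool) → Set
OptimalP̂ w p s x = FeasibleP̂ p s x × (∀ y → FeasibleP̂ p s y → selℚ y w ≤ selℚ x w)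
  where open import Data.Product using (_×_)

bscale : (n : ℕ) → ℚ → ℚ → ℚ
bscale n ε sᵢ = (ε /ℚ ((ℤ.+ (suc n)) ℚ./ 1)) * sᵢ

phat : ∀ {m n} → ℚ → (Fin m → Fin n → ℚ) → (Fin m → ℚ) → Fin m → Fin n → ℤ
phat {n = n} ε p s i j = floor (p i j /ℚ bscale n ε (s i))

shat : ∀ {m} → (n : ℕ) → ℚ → (Fin m → ℚ) → Fin m → ℤ
shat n ε s i = ceiling (s i /ℚ bscale n ε (s i))

module Submission where

-- Fix a constraint i with scale b = b_i > 0.  For a 0/1 vector x write
-- sel x a = Σ_{j : x_j = 1} a_j.  Rounding each load down and the capacity
-- up relates the two programs in both directions:
--   * if sel x p ≤ s, then sel x ⌊p/b⌋ ≤ sel x (p/b) = (sel x p)/b ≤ s/b ≤ ⌈s/b⌉,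
--     so every feasible solution of P is feasible for P̂ (same weights);
--   * if sel x ⌊p/b⌋ ≤ ⌈s/b⌉, then each selected job loses less than one
--     unit by rounding down, so (sel x p)/b ≤ ⌈s/b⌉ + n ≤ s/b + (n+1),
--     i.e. sel x p ≤ s + (n+1) b = (1+ε) s for b = ε s/(n+1).

open import Defs
open import Data.Nat using (ℕ)
open import Data.Fin using (Fin)
open import Data.Bool using (Bool)
open import Data.Product using (_×_)
open import Data.Rational using (ℚ; 0ℚ; 1ℚ; _+_; _*_; _≤_; _<_)

open import Data.Nat as ℕ using (zero; suc)
open import Data.Bool using (true; false; if_then_else_)
open import Data.Product using (_,_)
open import Data.Integer as ℤ using (ℤ; +_; -[1+_])
import Data.Integer.Properties as ℤP
import Data.Integer.DivMod as ℤD
open import Data.Rational as ℚ using (mkℚ; *≤*; floor; ceiling; 1/_; -_; _≟_)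
import Data.Rational.Properties as ℚP
import Data.Rational.Unnormalised as ℚᵘ
import Data.Rational.Unnormalised.Properties as ℚᵘP
open import Data.Nat.Coprimality using (1-coprimeTo) renaming (sym to coprime-sym)
open import Relation.Binary.PropositionalEquality
open import Relation.Nullary using (yes; no; ¬_)
open import Data.Empty using (⊥-elim)
import Data.Integer.Tactic.RingSolver as ℤ-Ring
import Tactic.RingSolver as RingSolver
open import Tactic.RingSolver.Core.AlmostCommutativeRing using (AlmostCommutativeRing; fromCommutativeRing)
import Relation.Nullary.Decidable.Core as DecCore
open import Level using (0ℓ)

ℚ-ring : AlmostCommutativeRing 0ℓ 0ℓ
ℚ-ring = fromCommutativeRing ℚP.+-*-commutativeRing (λ x → DecCore.dec⇒maybe (0ℚ ≟ x))

-- Integers inside ℚ, with the same constructor Defs uses for n+1.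
ι : ℤ → ℚ
ι z = z ℚ./ 1

ι-normal : ∀ z → ι z ≡ mkℚ z 0 (coprime-sym (1-coprimeTo _))
ι-normal (+ n)    = ℚP.normalize-coprime {n} {0} (coprime-sym (1-coprimeTo _))
ι-normal -[1+ m ] = cong -_ (ℚP.normalize-coprime {suc m} {0} (coprime-sym (1-coprimeTo _)))

ι-mono : ∀ {a b} → a ℤ.≤ b → ι a ≤ ι b
ι-mono {a} {b} a≤b rewrite ι-normal a | ι-normal b = *≤* (ℤP.*-monoʳ-≤-nonNeg (+ 1) a≤b)

ι-cancel : ∀ {a b} → ι a ≤ ι b → a ℤ.≤ b
ι-cancel {a} {b} ιa≤ιb rewrite ι-normal a | ι-normal b with ιa≤ιb
... | *≤* a*1≤b*1 = subst₂ ℤ._≤_ (ℤP.*-identityʳ a) (ℤP.*-identityʳ b) a*1≤b*1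

ι-+ : ∀ a b → ι (a ℤ.+ b) ≡ ι a + ι b
ι-+ a b = ℚP.toℚᵘ-injective (ℚᵘP.≃-trans unnormalised (ℚᵘP.≃-sym (ℚP.toℚᵘ-homo-+ (ι a) (ι b))))
  where
  cross-multiplied : ∀ a b → (a ℤ.+ b) ℤ.* + 1 ≡ (a ℤ.* + 1 ℤ.+ b ℤ.* + 1) ℤ.* + 1
  cross-multiplied = ℤ-Ring.solve-∀
  unnormalised : ℚ.toℚᵘ (ι (a ℤ.+ b)) ℚᵘ.≃ (ℚ.toℚᵘ (ι a) ℚᵘ.+ ℚ.toℚᵘ (ι b))
  unnormalised rewrite ι-normal (a ℤ.+ b) | ι-normal a | ι-normal b = ℚᵘ.*≡* (cross-multiplied a b)

ι-neg : ∀ z → ι (ℤ.- z) ≡ - ι z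
ι-neg z rewrite ι-normal (ℤ.- z) | ι-normal z with z
... | + zero    = refl
... | + (suc _) = refl
... | -[1+ _ ]  = refl

floor-lower : ∀ q → ι (floor q) ≤ q
floor-lower q@(mkℚ a d-1 _) rewrite ι-normal (floor q) =
  *≤* (subst (floor q ℤ.* + suc d-1 ℤ.≤_) (sym (ℤP.*-identityʳ a)) (ℤD.[n/d]*d≤n a (+ suc d-1)))

floor-upper : ∀ q → q ≤ ι (floor q) + 1ℚ
floor-upper q@(mkℚ a d-1 _) rewrite sym (ι-+ (floor q) (+ 1)) | ι-normal (floor q ℤ.+ + 1) =
  *≤* (subst₂ ℤ._≤_ (sym (ℤP.*-identityʳ a)) (cong (ℤ._* + suc d-1) (ℤP.+-comm (+ 1) (floor q)))
                    (ℤP.<⇒≤ a<⌊q⌋+1))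
  where
  a<⌊q⌋+1 : a ℤ.< ℤ.suc (floor q) ℤ.* + suc d-1
  a<⌊q⌋+1 = subst (λ t → a ℤ.< ℤ.suc t ℤ.* + suc d-1) (sym (ℤD.div-pos-is-/ℕ a (suc d-1)))
                  (ℤD.n<s[n/ℕd]*d a (suc d-1))

neg-involutive : ∀ q → - (- q) ≡ q
neg-involutive (mkℚ (+ zero)    _ _) = refl
neg-involutive (mkℚ (+ (suc _)) _ _) = refl
neg-involutive (mkℚ -[1+ _ ]    _ _) = refl

-- ⌈q⌉ = -⌊-q⌋, so the ceiling bounds are the floor bounds of -q, negated.
ceiling-lower : ∀ q → q ≤ ι (ceiling q)
ceiling-lower q@record{} = begin
  q                    ≡⟨ neg-involutive q ⟨
  - (- q)              ≤⟨ ℚP.neg-antimono-≤ (floor-lower (- q)) ⟩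
  - ι (floor (- q))    ≡⟨ ι-neg (floor (- q)) ⟨
  ι (ceiling q)        ∎
  where open ℚP.≤-Reasoning

ceiling-upper : ∀ q → ι (ceiling q) ≤ q + 1ℚ
ceiling-upper q@record{} = begin
  ι (ceiling q)                   ≡⟨ ι-neg (floor (- q)) ⟩
  - f                             ≡⟨ shift f ⟩
  - (f + 1ℚ) + 1ℚ                 ≤⟨ ℚP.+-monoˡ-≤ 1ℚ (ℚP.neg-antimono-≤ (floor-upper (- q))) ⟩
  - (- q) + 1ℚ                    ≡⟨ cong (_+ 1ℚ) (neg-involutive q) ⟩
  q + 1ℚ                          ∎
  where
  open ℚP.≤-Reasoning
  f = ι (floor (- q))
  shift : ∀ f → - f ≡ - (f + 1ℚ) + 1ℚ
  shift = RingSolver.solve-∀ ℚ-ring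

Σ-cong : ∀ {n} {f g : Fin n → ℚ} → (∀ j → f j ≡ g j) → Σℚ f ≡ Σℚ g
Σ-cong {zero}  f≡g = refl
Σ-cong {suc n} f≡g = cong₂ _+_ (f≡g Fin.zero) (Σ-cong (λ j → f≡g (Fin.suc j)))

Σ-mono : ∀ {n} {f g : Fin n → ℚ} → (∀ j → f j ≤ g j) → Σℚ f ≤ Σℚ g
Σ-mono {zero}  f≤g = ℚP.≤-refl
Σ-mono {suc n} f≤g = ℚP.+-mono-≤ (f≤g Fin.zero) (Σ-mono (λ j → f≤g (Fin.suc j)))

Σ-+ : ∀ {n} (f g : Fin n → ℚ) → Σℚ (λ j → f j + g j) ≡ Σℚ f + Σℚ g
Σ-+ {zero}  f g = refl
Σ-+ {suc n} f g rewrite Σ-+ (λ j → f (Fin.suc j)) (λ j → g (Fin.suc j)) = interchange (f Fin.zero) (g Fin.zero) _ _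
  where
  interchange : ∀ a b c d → (a + b) + (c + d) ≡ (a + c) + (b + d)
  interchange = RingSolver.solve-∀ ℚ-ring

Σ-*ʳ : ∀ {n} (f : Fin n → ℚ) (c : ℚ) → Σℚ (λ j → f j * c) ≡ Σℚ f * c
Σ-*ʳ {zero}  f c = sym (ℚP.*-zeroˡ c)
Σ-*ʳ {suc n} f c rewrite Σ-*ʳ (λ j → f (Fin.suc j)) c = sym (ℚP.*-distribʳ-+ c (f Fin.zero) _)

Σ-ι : ∀ {n} (g : Fin n → ℤ) → ι (Σℤ g) ≡ Σℚ (λ j → ι (g j))
Σ-ι {zero}  g = refl
Σ-ι {suc n} g rewrite sym (Σ-ι (λ j → g (Fin.suc j))) = ι-+ (g Fin.zero) _

Σ-1 : ∀ n → Σℚ {n} (λ _ → 1ℚ) ≡ ι (+ n)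
Σ-1 zero    = refl
Σ-1 (suc n) rewrite Σ-1 n = sym (ι-+ (+ 1) (+ n))

sel-ι : ∀ {n} (x : Fin n → Bool) (g : Fin n → ℤ) → ι (selℤ x g) ≡ selℚ x (λ j → ι (g j))
sel-ι x g = trans (Σ-ι (λ j → if x j then g j else + 0)) (Σ-cong ι-if)
  where
  ι-if : ∀ j → ι (if x j then g j else + 0) ≡ (if x j then ι (g j) else 0ℚ)
  ι-if j with x j
  ... | true  = refl
  ... | false = refl

sel-*ʳ : ∀ {n} (x : Fin n → Bool) (a : Fin n → ℚ) (c : ℚ) → selℚ x (λ j → a j * c) ≡ selℚ x a * c
sel-*ʳ x a c = trans (Σ-cong *-if) (Σ-*ʳ (λ j → if x j then a j else 0ℚ) c)
  where
  *-if : ∀ j → (if x j then a j * c else 0ℚ) ≡ (if x j then a j else 0ℚ) * c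
  *-if j with x j
  ... | true  = refl
  ... | false = sym (ℚP.*-zeroˡ c)

sel-floor-lower : ∀ {n} (x : Fin n → Bool) (q : Fin n → ℚ) → ι (selℤ x (λ j → floor (q j))) ≤ selℚ x q
sel-floor-lower x q = ℚP.≤-trans (ℚP.≤-reflexive (sel-ι x _)) (Σ-mono termwise)
  where
  termwise : ∀ j → (if x j then ι (floor (q j)) else 0ℚ) ≤ (if x j then q j else 0ℚ)
  termwise j with x j
  ... | true  = floor-lower (q j)
  ... | false = ℚP.≤-refl

sel-floor-upper : ∀ {n} (x : Fin n → Bool) (q : Fin n → ℚ) →
                  selℚ x q ≤ ι (selℤ x (λ j → floor (q j))) + ι (+ n)
sel-floor-upper {n} x q = begin
  selℚ x q                                               ≤⟨ Σ-mono termwise ⟩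
  Σℚ (λ j → (if x j then ι (floor (q j)) else 0ℚ) + 1ℚ)   ≡⟨ Σ-+ (λ j → if x j then ι (floor (q j)) else 0ℚ) (λ _ → 1ℚ) ⟩
  selℚ x (λ j → ι (floor (q j))) + Σℚ {n} (λ _ → 1ℚ)      ≡⟨ cong₂ _+_ (sel-ι x _) (sym (Σ-1 n)) ⟨
  ι (selℤ x (λ j → floor (q j))) + ι (+ n)               ∎
  where
  open ℚP.≤-Reasoning
  termwise : ∀ j → (if x j then q j else 0ℚ) ≤ (if x j then ι (floor (q j)) else 0ℚ) + 1ℚ
  termwise j with x j
  ... | true  = floor-upper (q j)
  ... | false = ℚP.<⇒≤ (ℚP.positive⁻¹ 1ℚ)

module PositiveDivision {b : ℚ} (0<b : 0ℚ < b) where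

  b≢0 : ¬ (b ≡ 0ℚ)
  b≢0 b≡0 = ℚP.<⇒≢ 0<b (sym b≡0)

  instance
    b-positive : ℚ.Positive b
    b-positive = ℚ.positive 0<b
    b-nonZero : ℚ.NonZero b
    b-nonZero = ℚP.pos⇒nonZero b
    b-nonNegative : ℚ.NonNegative b
    b-nonNegative = ℚP.pos⇒nonNeg b
    1/b-nonNegative : ℚ.NonNegative (1/ b)
    1/b-nonNegative = ℚP.pos⇒nonNeg (1/ b) {{ℚP.1/pos⇒pos b}}

  /b≡*1/b : ∀ a → a /ℚ b ≡ a * 1/ b
  /b≡*1/b a with b ≟ 0ℚ
  ... | yes b≡0 = ⊥-elim (b≢0 b≡0)
  ... | no  _   = refl

  /b-positive : ∀ {a} → 0ℚ < a → 0ℚ < a /ℚ b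
  /b-positive {a} 0<a rewrite /b≡*1/b a =
    ℚP.positive⁻¹ _ {{ℚP.pos*pos⇒pos a {{ℚ.positive 0<a}} (1/ b) {{ℚP.1/pos⇒pos b}}}}

  /b-mono : ∀ {a c} → a ≤ c → a /ℚ b ≤ c /ℚ b
  /b-mono {a} {c} a≤c rewrite /b≡*1/b a | /b≡*1/b c = ℚP.*-monoʳ-≤-nonNeg (1/ b) a≤c

  /b-*b : ∀ a → a /ℚ b * b ≡ a
  /b-*b a = begin
    a /ℚ b * b       ≡⟨ cong (_* b) (/b≡*1/b a) ⟩
    a * 1/ b * b     ≡⟨ ℚP.*-assoc a (1/ b) b ⟩
    a * (1/ b * b)   ≡⟨ cong (a *_) (ℚP.*-inverseˡ b) ⟩
    a * 1ℚ           ≡⟨ ℚP.*-identityʳ a ⟩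
    a                ∎
    where open ≡-Reasoning

  sel-/b : ∀ {n} (x : Fin n → Bool) (a : Fin n → ℚ) → selℚ x (λ j → a j /ℚ b) ≡ selℚ x a /ℚ b
  sel-/b x a = begin
    selℚ x (λ j → a j /ℚ b)     ≡⟨ Σ-cong (λ j → cong (λ t → if x j then t else 0ℚ) (/b≡*1/b (a j))) ⟩
    selℚ x (λ j → a j * 1/ b)   ≡⟨ sel-*ʳ x a (1/ b) ⟩
    selℚ x a * 1/ b             ≡⟨ /b≡*1/b (selℚ x a) ⟨
    selℚ x a /ℚ b               ∎
    where open ≡-Reasoning

rounding-preserves-feasibility :
  ∀ {n} (x : Fin n → Bool) (P : Fin n → ℚ) (S b : ℚ) → 0ℚ < b → selℚ x P ≤ S →
  selℤ x (λ j → floor (P j /ℚ b)) ℤ.≤ ceiling (S /ℚ b)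
rounding-preserves-feasibility x P S b 0<b feasible = ι-cancel (begin
  ι (selℤ x (λ j → floor (P j /ℚ b)))   ≤⟨ sel-floor-lower x _ ⟩
  selℚ x (λ j → P j /ℚ b)               ≡⟨ sel-/b x P ⟩
  selℚ x P /ℚ b                         ≤⟨ /b-mono feasible ⟩
  S /ℚ b                                ≤⟨ ceiling-lower (S /ℚ b) ⟩
  ι (ceiling (S /ℚ b))                  ∎)
  where
  open ℚP.≤-Reasoning
  open PositiveDivision 0<b

rounding-overshoot :
  ∀ {n} (x : Fin n → Bool) (P : Fin n → ℚ) (S b : ℚ) → 0ℚ < b →
  selℤ x (λ j → floor (P j /ℚ b)) ℤ.≤ ceiling (S /ℚ b) →
  selℚ x P ≤ S + ι (+ suc n) * b
rounding-overshoot {n} x P S b 0<b roundedFeasible = begin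
  selℚ x P                                            ≡⟨ /b-*b (selℚ x P) ⟨
  selℚ x P /ℚ b * b                                   ≡⟨ cong (_* b) (sel-/b x P) ⟨
  selℚ x (λ j → P j /ℚ b) * b                         ≤⟨ ℚP.*-monoʳ-≤-nonNeg b (sel-floor-upper x _) ⟩
  (ι (selℤ x (λ j → floor (P j /ℚ b))) + ι (+ n)) * b  ≤⟨ ℚP.*-monoʳ-≤-nonNeg b (ℚP.+-monoˡ-≤ (ι (+ n)) (ι-mono roundedFeasible)) ⟩
  (ι (ceiling (S /ℚ b)) + ι (+ n)) * b                 ≤⟨ ℚP.*-monoʳ-≤-nonNeg b (ℚP.+-monoˡ-≤ (ι (+ n)) (ceiling-upper (S /ℚ b))) ⟩
  (S /ℚ b + 1ℚ + ι (+ n)) * b                          ≡⟨ regroup (S /ℚ b) (ι (+ n)) b ⟩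
  S /ℚ b * b + (1ℚ + ι (+ n)) * b                      ≡⟨ cong₂ (λ u v → u + v * b) (/b-*b S) (sym (ι-+ (+ 1) (+ n))) ⟩
  S + ι (+ suc n) * b                                  ∎
  where
  open ℚP.≤-Reasoning
  open PositiveDivision 0<b
  regroup : ∀ u k b → (u + 1ℚ + k) * b ≡ u * b + (1ℚ + k) * b
  regroup = RingSolver.solve-∀ ℚ-ring

ι-suc-positive : ∀ n → 0ℚ < ι (+ suc n)
ι-suc-positive n = ℚP.positive⁻¹ _ {{ℚP.normalize-pos (suc n) 1}}

bscale-positive : ∀ n {ε s} → 0ℚ < ε → 0ℚ < s → 0ℚ < bscale n ε s
bscale-positive n {ε} {s} 0<ε 0<s =
  ℚP.positive⁻¹ _ {{ℚP.pos*pos⇒pos (ε /ℚ ι (+ suc n)) {{ℚ.positive (/b-positive 0<ε)}} s {{ℚ.positive 0<s}}}}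
  where open PositiveDivision (ι-suc-positive n)

bscale-total : ∀ n ε s → ι (+ suc n) * bscale n ε s ≡ ε * s
bscale-total n ε s = begin
  N * ((ε /ℚ N) * s)   ≡⟨ reassociate N (ε /ℚ N) s ⟩
  (ε /ℚ N * N) * s     ≡⟨ cong (_* s) (/b-*b ε) ⟩
  ε * s                ∎
  where
  open ≡-Reasoning
  N = ι (+ suc n)
  open PositiveDivision (ι-suc-positive n)
  reassociate : ∀ N a s → N * (a * s) ≡ (a * N) * s
  reassociate = RingSolver.solve-∀ ℚ-ring

lemma11 : (m n : ℕ) (ε : ℚ) (w : Fin n → ℚ) (p : Fin m → Fin n → ℚ) (s : Fin m → ℚ) →
    0ℚ < ε → (∀ j → 0ℚ ≤ w j) → (∀ i j → 0ℚ ≤ p i j) → (∀ i → 0ℚ < s i) →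
    (x̂ : Fin n → Bool) → OptimalP̂ w (phat ε p s) (shat n ε s) x̂ →
    (∀ x → OptimalP w p s x → selℚ x w ≤ selℚ x̂ w)
    × (∀ i → selℚ x̂ (p i) ≤ (1ℚ + ε) * s i)
lemma11 m n ε w p s 0<ε _ _ 0<s x̂ (x̂-feasible , x̂-optimal) = dominates , nearly-feasible
  where
  0<b : ∀ i → 0ℚ < bscale n ε (s i)
  0<b i = bscale-positive n 0<ε (0<s i)

  -- An optimum of P is feasible for P̂, so it cannot beat the optimum x̂ of P̂.
  dominates : ∀ x → OptimalP w p s x → selℚ x w ≤ selℚ x̂ w
  dominates x (x-feasible , _) =
    x̂-optimal x (λ i → rounding-preserves-feasibility x (p i) (s i) _ (0<b i) (x-feasible i))

  -- x̂ overshoots each capacity s_i by at most (n+1) b_i = ε s_i.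
  nearly-feasible : ∀ i → selℚ x̂ (p i) ≤ (1ℚ + ε) * s i
  nearly-feasible i = ℚP.≤-trans (rounding-overshoot x̂ (p i) (s i) _ (0<b i) (x̂-feasible i))
    (ℚP.≤-reflexive (trans (cong (λ t → s i + t) (bscale-total n ε (s i))) (factor (s i) ε)))
    where
    factor : ∀ s ε → s + ε * s ≡ (1ℚ + ε) * s
    factor = RingSolver.solve-∀ ℚ-ring
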